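{- Let $H$ be a connected plane graph. If for every vertex $u$ of $H$ there exists a face $f$ of $H$ such that $u\in\mathrm{qcc}_H(H[f])$, then for every cycle $C$ of $H$ and all vertices $a,b$ of $H$ with $a$ in the interior and $b$ in the exterior of $C$, either $d(a,V(C))\leq\mathrm{diam}(C)$ or $d(b,V(C))\leq\mathrm{diam}(C)$.
   Context: $d$ denotes shortest-path distance in $H$, with $d(v,A)=\min_{a\in A}d(v,a)$; $\mathrm{diam}(C)$ is the diameter of the cycle $C$ as a graph. For a face $f$ of a plane graph $H$, $H[f]$ is the subgraph formed by the vertices and edges on the boundary of $f$. For $S\subseteq V(H)$, $\mathrm{qcc}_H(S)=\{u\in V(H): \forall v\in V(H)\ \exists s\in S \text{ with } d_H(u,s)\geq d_H(v,s)\}$ (for a subgraph, use its vertex set). -}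

module Defs where

open import Data.Nat using (ℕ; zero; suc; _+_; _∸_; _≤_; _<_)
open import Data.Fin using (Fin; toℕ)
open import Data.Product using (Σ; ∃; _×_; _,_)
open import Data.Sum using (_⊎_)
open import Relation.Nullary using (¬_)
open import Relation.Binary.PropositionalEquality using (_≡_; _≢_)
open import Relation.Binary.Construct.Closure.ReflexiveTransitive using (Star)

data Walk {V : Set} (R : V → V → Set) : V → V → ℕ → Set where
  nil  : ∀ {u} → Walk R u u 0
  cons : ∀ {u v w k} → R u v → Walk R v w k → Walk R u w (suc k)

IsDist : {V : Set} → (V → V → Set) → V → V → ℕ → Set
IsDist R u v k = Walk R u v k × (∀ j → Walk R u v j → k ≤ j)

IsDiam : {V : Set} → (V → V → Set) → ℕ → Set
IsDiam {V} R D =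
  (∀ u v → Σ ℕ λ k → k ≤ D × Walk R u v k) ×
  (Σ V λ u → Σ V λ v → ∀ j → Walk R u v j → D ≤ j)

iter : {A : Set} → (A → A) → ℕ → A → A
iter f zero    x = x
iter f (suc k) x = f (iter f k x)

-- Connected plane graphs, encoded as combinatorial maps (rotation
-- systems) of Euler genus 0, with a designated outer face.
-- Darts: Fin (m + m); each edge gives two opposite darts (α);
-- σ is the rotation around vertices; faces are orbits of φ = σ ∘ α.

record PlaneGraph : Set where
  field
    n m     : ℕ
  Vertex = Fin n
  Dart   = Fin (m + m)
  field
    tail    : Dart → Vertex
    α       : Dart → Dart
    α-invol : ∀ d → α (α d) ≡ d
    α-nofix : ∀ d → α d ≢ d
    σ       : Dart → Dart
    σ⁻¹     : Dart → Dart
    σσ⁻¹    : ∀ d → σ (σ⁻¹ d) ≡ d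
    σ⁻¹σ    : ∀ d → σ⁻¹ (σ d) ≡ d
    σ-tail  : ∀ d → tail (σ d) ≡ tail d
    σ-trans : ∀ d e → tail d ≡ tail e → Σ ℕ λ k → iter σ k d ≡ e
    noloop  : ∀ d → tail d ≢ tail (α d)
    noparal : ∀ d e → tail d ≡ tail e → tail (α d) ≡ tail (α e) → d ≡ e
  Adj : Vertex → Vertex → Set
  Adj u v = Σ Dart λ d → tail d ≡ u × tail (α d) ≡ v
  φ : Dart → Dart
  φ d = σ (α d)
  SameFace : Dart → Dart → Set
  SameFace d e = Σ ℕ λ k → iter φ k d ≡ e
  field
    connected : ∀ (u v : Vertex) → Σ ℕ λ k → Walk Adj u v k
    -- Euler's formula n − m + f = 2 (genus 0), f = number of φ-orbits
    nfaces    : ℕ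
    faceOf    : Dart → Fin nfaces
    faceOf-surj : ∀ (i : Fin nfaces) → Σ Dart λ d → faceOf d ≡ i
    faceOf-same : ∀ d e → faceOf d ≡ faceOf e → SameFace d e
    same-faceOf : ∀ d e → SameFace d e → faceOf d ≡ faceOf e
    euler     : n + nfaces ≡ m + 2
    outer     : Dart

  Dist : Vertex → Vertex → ℕ → Set
  Dist = IsDist Adj

  OnFace : Dart → Vertex → Set
  OnFace d u = Σ ℕ λ k → tail (iter φ k d) ≡ u

  InQcc : (Vertex → Set) → Vertex → Set
  InQcc S u = ∀ (v : Vertex) → Σ Vertex λ s → S s ×
                (∀ k l → Dist u s k → Dist v s l → l ≤ k)

Consec : {len : ℕ} → Fin len → Fin len → Set
Consec {len} i j = (toℕ j ≡ suc (toℕ i)) ⊎ (toℕ i ≡ len ∸ 1 × toℕ j ≡ 0)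

CycAdj : {len : ℕ} → Fin len → Fin len → Set
CycAdj i j = Consec i j ⊎ Consec j i

record Cycle (H : PlaneGraph) : Set where
  open PlaneGraph H
  field
    len    : ℕ
    len≥3  : 3 ≤ len
    vtx    : Fin len → Vertex
    vtx-inj : ∀ i j → vtx i ≡ vtx j → i ≡ j
    vtx-adj : ∀ i j → Consec i j → Adj (vtx i) (vtx j)

module _ {H : PlaneGraph} (C : Cycle H) where
  open PlaneGraph H
  open Cycle C

  OnC : Vertex → Set
  OnC v = Σ (Fin len) λ i → vtx i ≡ v

  CDart : Dart → Set
  CDart d = Σ (Fin len) λ i → Σ (Fin len) λ j → Consec i j ×
    ((tail d ≡ vtx i × tail (α d) ≡ vtx j) ⊎ (tail d ≡ vtx j × tail (α d) ≡ vtx i))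

  -- moving between darts without crossing an edge of C
  Step : Dart → Dart → Set
  Step d e = (e ≡ φ d) ⊎ (d ≡ φ e) ⊎ (e ≡ α d × ¬ CDart d)

  -- dart d lies on a face in the exterior region of C
  ExtDart : Dart → Set
  ExtDart d = Star Step outer d

  InInterior : Vertex → Set
  InInterior a = ¬ OnC a × (∀ d → tail d ≡ a → ¬ ExtDart d)

  InExterior : Vertex → Set
  InExterior b = ¬ OnC b × (∀ d → tail d ≡ b → ExtDart d)

  DistToC≤ : Vertex → ℕ → Set
  DistToC≤ v D = Σ (Fin len) λ i → Σ ℕ λ k → k ≤ D × Walk Adj v (vtx i) k

  DiamC : ℕ → Set
  DiamC D = IsDiam (CycAdj {len}) D

{-# OPTIONS --safe #-}
-- Fix a vertex c of C and a face f with c ∈ qcc(H[f]); each v ∈ {a, b} then has a vertex s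
-- on f with d(v,s) ≤ d(c,s). If a shortest v–s path meets C at vtx i, after t steps and with
-- r steps left, then t + r = d(v,s) ≤ d(c,s) ≤ diam(C) + r, so d(v,C) ≤ t ≤ diam(C).
-- If neither path meets C, then a and b both lie in the region of C containing f, which is
-- impossible since C separates them.
module Submission where

open import Defs
open import Data.Nat using (ℕ; zero; suc; _+_; _≤_; _<_; s≤s; z≤n)
open import Data.Nat.Properties
  using (≮⇒≥; anyUpTo?; ≤-trans; +-monoˡ-≤; +-cancelʳ-≤; module ≤-Reasoning)
open import Data.Nat.Induction using (<-rec)
open import Data.Fin using (Fin; _≟_; fromℕ<)
open import Data.Fin.Properties using (any?)
open import Data.Product using (Σ; _×_; _,_)
open import Data.Sum using (_⊎_; inj₁; inj₂)
open import Data.Empty using (⊥-elim)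
open import Function using (case_of_)
open import Relation.Nullary using (¬_; Dec; yes; no; _×-dec_)
open import Relation.Nullary.Decidable using (map′)
open import Relation.Unary using (Decidable)
open import Relation.Binary using (Symmetric)
open import Relation.Binary.PropositionalEquality using (_≡_; refl; sym; trans; cong; subst)
open import Relation.Binary.Construct.Closure.ReflexiveTransitive using (Star; ε; _◅_; _◅◅_; reverse)

_++ʷ_ : {V : Set} {R : V → V → Set} {u v w : V} {k j : ℕ} →
        Walk R u v k → Walk R v w j → Walk R u w (k + j)
nil      ++ʷ q = q
cons r p ++ʷ q = cons r (p ++ʷ q)

mapʷ : {V W : Set} {R : V → V → Set} {S : W → W → Set} (f : V → W) →
       (∀ {x y} → R x y → S (f x) (f y)) →
       ∀ {u v k} → Walk R u v k → Walk S (f u) (f v) k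
mapʷ f g nil        = nil
mapʷ f g (cons r p) = cons (g r) (mapʷ f g p)

Least : (ℕ → Set) → Set
Least P = Σ ℕ λ j → P j × (∀ i → P i → j ≤ i)

least : {P : ℕ → Set} → Decidable P → ∀ k → P k → Least P
least {P} P? = <-rec (λ k → P k → Least P) search
  where
    search : ∀ k → (∀ {j} → j < k → P j → Least P) → P k → Least P
    search k below Pk = case anyUpTo? P? k of λ where
      (yes (j , j<k , Pj)) → below j<k Pj
      (no ∄j<k)            → k , Pk , λ i Pi → ≮⇒≥ (λ i<k → ∄j<k (i , i<k , Pi))

module _ (H : PlaneGraph) where
  open PlaneGraph H

  Adj? : ∀ u v → Dec (Adj u v)
  Adj? u v = any? (λ d → (tail d ≟ u) ×-dec (tail (α d) ≟ v))

  Walk? : ∀ k u v → Dec (Walk Adj u v k)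
  Walk? zero    u v = map′ (λ { refl → nil }) (λ { nil → refl }) (u ≟ v)
  Walk? (suc k) u v = map′ (λ { (w , e , p) → cons e p }) (λ { (cons e p) → _ , e , p })
                           (any? λ w → Adj? u w ×-dec Walk? k w v)

  distance : ∀ u v → Σ ℕ (Dist u v)
  distance u v with connected u v
  ... | k , p = least (λ j → Walk? j u v) k p

  Adj-sym : Symmetric Adj
  Adj-sym (d , td , tαd) = α d , tαd , trans (cong tail (α-invol d)) td

  tail-iterσ : ∀ k d → tail (iter σ k d) ≡ tail d
  tail-iterσ zero    d = refl
  tail-iterσ (suc k) d = trans (σ-tail (iter σ k d)) (tail-iterσ k d)

  module _ (C : Cycle H) where
    open Cycle C

    position₀ : Fin len
    position₀ = fromℕ< (≤-trans (s≤s z≤n) len≥3)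

    Reach : Dart → Dart → Set
    Reach = Star (Step C)

    OnC? : ∀ v → Dec (OnC C v)
    OnC? v = any? (λ i → vtx i ≟ v)

    CDart⇒OnC : ∀ {d} → CDart C d → OnC C (tail d)
    CDart⇒OnC (i , j , _ , inj₁ (td , _)) = i , sym td
    CDart⇒OnC (i , j , _ , inj₂ (td , _)) = j , sym td

    CDart-α : ∀ {d} → CDart C d → CDart C (α d)
    CDart-α {d} (i , j , c , inj₁ (td , tαd)) = i , j , c , inj₂ (tαd , trans (cong tail (α-invol d)) td)
    CDart-α {d} (i , j , c , inj₂ (td , tαd)) = i , j , c , inj₁ (tαd , trans (cong tail (α-invol d)) td)

    Step-sym : Symmetric (Step C)
    Step-sym (inj₁ e≡φd)                = inj₂ (inj₁ e≡φd)
    Step-sym (inj₂ (inj₁ d≡φe))         = inj₁ d≡φe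
    Step-sym {d} (inj₂ (inj₂ (refl , ¬cd))) =
      inj₂ (inj₂ (sym (α-invol d) , λ cd → ¬cd (subst (CDart C) (α-invol d) (CDart-α cd))))

    Reach-sym : Symmetric Reach
    Reach-sym = reverse Step-sym

    Reach-φ : ∀ k d → Reach d (iter φ k d)
    Reach-φ zero    d = ε
    Reach-φ (suc k) d = Reach-φ k d ◅◅ (inj₁ refl ◅ ε)

    Step-α : ∀ {v d} → ¬ OnC C v → tail d ≡ v → Step C d (α d)
    Step-α v∉C refl = inj₂ (inj₂ (refl , λ cd → v∉C (CDart⇒OnC cd)))

    Reach-σ : ∀ {v d} → ¬ OnC C v → tail d ≡ v → Reach d (σ d)
    Reach-σ {d = d} v∉C td =
      Step-α v∉C td ◅ subst (λ e → Step C (α d) (σ e)) (α-invol d) (inj₁ refl) ◅ ε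

    Reach-around : ∀ {v x y} → ¬ OnC C v → tail x ≡ v → tail y ≡ v → Reach x y
    Reach-around {v} {x} v∉C tx ty with σ-trans x _ (trans tx (sym ty))
    ... | k , σᵏx≡y = subst (Reach x) σᵏx≡y (rotate k)
      where
        rotate : ∀ k → Reach x (iter σ k x)
        rotate zero    = ε
        rotate (suc k) = rotate k ◅◅ Reach-σ v∉C (trans (tail-iterσ k x) tx)

    Linked : Vertex → Vertex → Set
    Linked u w = ∀ y → tail y ≡ w → Σ Dart λ x → tail x ≡ u × Reach y x

    ThroughC : Vertex → Vertex → ℕ → Set
    ThroughC u w l = Σ (Fin len) λ i → Σ ℕ λ t → Σ ℕ λ r → t + r ≡ l ×
                       Walk Adj u (vtx i) t × Walk Adj (vtx i) w r

    through-C-or-linked : ∀ {u w l} → Walk Adj u w l → ThroughC u w l ⊎ (¬ OnC C u × Linked u w)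
    through-C-or-linked {u} p with OnC? u
    ... | yes (i , refl) = inj₁ (i , 0 , _ , refl , nil , p)
    through-C-or-linked nil | no u∉C = inj₂ (u∉C , λ y ty → y , ty , ε)
    through-C-or-linked {u} {w} (cons (d , td , tαd) p) | no u∉C with through-C-or-linked p
    ... | inj₁ (i , t , r , t+r≡l , v→i , i→w) =
      inj₁ (i , suc t , r , cong suc t+r≡l , cons (d , td , tαd) v→i , i→w)
    ... | inj₂ (v∉C , linked) = inj₂ (u∉C , extend)
      where
        extend : Linked u w
        extend y ty with linked y ty
        ... | x , tx , y↝x =
          d , td , (y↝x ◅◅ Reach-around v∉C tx tαd ◅◅ (Step-sym (Step-α u∉C td) ◅ ε))

    CycAdj⇒Adj : ∀ {i j} → CycAdj {len} i j → Adj (vtx i) (vtx j)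
    CycAdj⇒Adj {i} {j} (inj₁ c) = vtx-adj i j c
    CycAdj⇒Adj {i} {j} (inj₂ c) = Adj-sym (vtx-adj j i c)

    LinkedToFace : Dart → Vertex → Set
    LinkedToFace f v = Σ ℕ λ k → Linked v (tail (iter φ k f))

    near-C-or-linked-to-face : ∀ D → (∀ i j → Σ ℕ λ p → p ≤ D × Walk (CycAdj {len}) i j p) →
      ∀ c f → InQcc (OnFace f) (vtx c) → ∀ v → DistToC≤ C v D ⊎ LinkedToFace f v
    near-C-or-linked-to-face D diam c f c∈qcc v with c∈qcc v
    ... | s , (k , refl) , closer with distance v s | distance (vtx c) s
    ... | l , v→s@(W , _) | K , c→s@(_ , K-min) with through-C-or-linked W
    ... | inj₂ (_ , linked) = inj₂ (k , linked)
    ... | inj₁ (i , t , r , t+r≡l , v→i , i→s) with diam c i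
    ... | p , p≤D , c→i = inj₁ (i , t , +-cancelʳ-≤ r t D t+r≤D+r , v→i)
      where
        open ≤-Reasoning
        t+r≤D+r : t + r ≤ D + r
        t+r≤D+r = begin
          t + r ≡⟨ t+r≡l ⟩
          l     ≤⟨ closer K l c→s v→s ⟩
          K     ≤⟨ K-min (p + r) (mapʷ vtx CycAdj⇒Adj c→i ++ʷ i→s) ⟩
          p + r ≤⟨ +-monoˡ-≤ r p≤D ⟩
          D + r ∎

    joined-through-face : ∀ {f a b} → LinkedToFace f a → LinkedToFace f b →
                          Σ Dart λ x → tail x ≡ a × Σ Dart λ y → tail y ≡ b × Reach y x
    joined-through-face {f} (k , a-linked) (k' , b-linked) with a-linked _ refl | b-linked _ refl
    ... | x , x-at-a , φᵏf↝x | y , y-at-b , φᵏ'f↝y =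
      x , x-at-a , y , y-at-b ,
      (Reach-sym φᵏ'f↝y ◅◅ Reach-sym (Reach-φ k' f) ◅◅ Reach-φ k f ◅◅ φᵏf↝x)

lemma9 : (H : PlaneGraph) →
    (∀ (u : PlaneGraph.Vertex H) → Σ (PlaneGraph.Dart H) λ f →
    PlaneGraph.InQcc H (PlaneGraph.OnFace H f) u) →
    ∀ (C : Cycle H) (a b : PlaneGraph.Vertex H) →
    InInterior C a → InExterior C b →
    ∀ (D : ℕ) → DiamC C D →
    DistToC≤ C a D ⊎ DistToC≤ C b D
lemma9 H qcc C a b (_ , a-interior) (_ , b-exterior) D (diam , _) with position₀ H C
... | c with qcc (Cycle.vtx C c)
... | f , c∈qcc with near-C-or-linked-to-face H C D diam c f c∈qcc a
                   | near-C-or-linked-to-face H C D diam c f c∈qcc b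
... | inj₁ a-near   | _             = inj₁ a-near
... | inj₂ _        | inj₁ b-near   = inj₂ b-near
... | inj₂ a-linked | inj₂ b-linked with joined-through-face H C a-linked b-linked
... | x , x-at-a , y , y-at-b , y↝x = ⊥-elim (a-interior x x-at-a (b-exterior y y-at-b ◅◅ y↝x))
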